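{- Let $\rho:2^E\to\mathbb{Z}_+$ be monotone submodular with $\rho(\emptyset)=0$ and $P=\{\boldsymbol{x}\in\mathbb{R}_+^E:\boldsymbol{x}(X)\le\rho(X)\ \forall X\subseteq E\}$. For $\boldsymbol{x}\in P$, let $C(\boldsymbol{x}):=\{\boldsymbol{y}\in\mathbb{R}^E:\lfloor\boldsymbol{x}\rfloor\le\boldsymbol{y}\le\lfloor\boldsymbol{x}\rfloor+\mathbf{1}\}$. Then $P\cap C(\boldsymbol{x})$ is a translation of a matroid polytope, i.e. there is a matroid $M$ on $E$ such that $P\cap C(\boldsymbol{x})=\lfloor\boldsymbol{x}\rfloor+P(M)$, where $P(M)$ is the convex hull of the characteristic vectors of independent sets of $M$.
   Context: $\boldsymbol{x}(X)=\sum_{i\in X}\boldsymbol{x}(i)$; $\lfloor\boldsymbol{x}\rfloor$ is the coordinatewise floor; $\mathbf{1}$ is the all-ones vector.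
   Formalization: The points of $P$, $C(\boldsymbol{x})$ and $P(M)$, including $\boldsymbol{x}$ itself, have rational rather than real coordinates, and the convex combinations defining $P(M)$ use rational coefficients. -}

module Defs where

open import Data.Nat using (ℕ; zero; suc) renaming (_+_ to _+ℕ_; _≤_ to _≤ℕ_; _<_ to _<ℕ_)
open import Data.Integer using (ℤ; +_)
open import Data.Rational using (ℚ; 0ℚ; 1ℚ; _+_; _*_; _≤_; floor; _/_)
open import Data.Fin using (Fin; zero; suc)
open import Data.Fin.Subset using (Subset; ⊥; _⊆_; _∪_; _∩_; _∈_; _∉_; ⁅_⁆; ∣_∣; inside; outside)
open import Data.Vec using ([]; _∷_; lookup)
open import Data.Bool using (Bool; true; false; if_then_else_)
open import Data.List using (List; []; _∷_)
open import Data.List.Relation.Unary.All using (All)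
open import Data.Product using (_×_; Σ; ∃; ∃-syntax; _,_; proj₁; proj₂)
open import Relation.Binary.PropositionalEquality using (_≡_)

Vecℚ : ℕ → Set
Vecℚ n = Fin n → ℚ

ℤ→ℚ : ℤ → ℚ
ℤ→ℚ z = z / 1

ℕ→ℚ : ℕ → ℚ
ℕ→ℚ k = (+ k) / 1

sumOn : ∀ {n} → Subset n → Vecℚ n → ℚ
sumOn {zero} [] x = 0ℚ
sumOn {suc n} (b ∷ X) x = (if b then x zero else 0ℚ) + sumOn X (λ i → x (suc i))

Monotone : ∀ {n} → (Subset n → ℕ) → Set
Monotone ρ = ∀ X Y → X ⊆ Y → ρ X ≤ℕ ρ Y

Submodular : ∀ {n} → (Subset n → ℕ) → Set
Submodular ρ = ∀ X Y → ρ (X ∪ Y) +ℕ ρ (X ∩ Y) ≤ℕ ρ X +ℕ ρ Y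

InP : ∀ {n} → (Subset n → ℕ) → Vecℚ n → Set
InP ρ x = (∀ i → 0ℚ ≤ x i) × (∀ X → sumOn X x ≤ ℕ→ℚ (ρ X))

⌊_⌋ᵥ : ∀ {n} → Vecℚ n → Vecℚ n
⌊ x ⌋ᵥ i = ℤ→ℚ (floor (x i))

InC : ∀ {n} → Vecℚ n → Vecℚ n → Set
InC x y = ∀ i → (⌊ x ⌋ᵥ i ≤ y i) × (y i ≤ ⌊ x ⌋ᵥ i + 1ℚ)

record Matroid (n : ℕ) : Set₁ where
  field
    Indep      : Subset n → Set
    indep-∅    : Indep ⊥
    indep-down : ∀ I J → I ⊆ J → Indep J → Indep I
    exchange   : ∀ I J → Indep I → Indep J → ∣ I ∣ <ℕ ∣ J ∣ →
                 ∃[ e ] (e ∈ J × e ∉ I × Indep (I ∪ ⁅ e ⁆))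

χ : ∀ {n} → Subset n → Vecℚ n
χ I i = if lookup I i then 1ℚ else 0ℚ

coeffSum : ∀ {n} → List (ℚ × Subset n) → ℚ
coeffSum [] = 0ℚ
coeffSum ((c , _) ∷ ps) = c + coeffSum ps

combo : ∀ {n} → List (ℚ × Subset n) → Vecℚ n
combo [] i = 0ℚ
combo ((c , I) ∷ ps) i = c * χ I i + combo ps i

InMatroidPolytope : ∀ {n} → Matroid n → Vecℚ n → Set
InMatroidPolytope M y =
  ∃[ ps ] ( All (λ p → (0ℚ ≤ proj₁ p) × Matroid.Indep M (proj₂ p)) ps
          × coeffSum ps ≡ 1ℚ
          × (∀ i → y i ≡ combo ps i) )

{-# OPTIONS --safe #-}
module Submission where

open import Defs
open import Data.Nat using (ℕ)
open import Data.Rational using (_+_)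
open import Data.Fin.Subset using (Subset; ⊥)
open import Data.Product using (_×_; ∃-syntax)
open import Function.Bundles using (_⇔_; mk⇔)
open import Relation.Binary.PropositionalEquality using (_≡_)

open import Algebra.Bundles using (CommutativeMonoid)
open import Data.Bool using (Bool; true; false; if_then_else_; _∧_; _∨_)
open import Data.Fin using (Fin; zero; suc)
open import Data.Fin.Properties using (suc-injective; any?) renaming (_≟_ to _≟ᶠ_)
open import Data.Fin.Subset using (_∪_; _∩_; ∁; ⊤; ⋃; _∈_; _∉_; ⁅_⁆; ∣_∣)
open import Data.Fin.Subset.Properties
  using ( _∈?_; anySubset?; ∉⊥; x∈⁅x⁆; x∈⁅y⁆⇒x≡y; x∈∁p⇒x∉p; x∈p∪q⁺; x∈p∩q⁺; x∈p∩q⁻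
        ; p∪∁p≡⊤; p∩q⊆p; p⊂q⇒∣p∣<∣q∣)
open import Data.Integer as ℤ using (ℤ)
import Data.Integer.Properties as ℤₚ
open import Data.Integer.DivMod using (div-pos-is-/ℕ; [n/ℕd]*d≤n; 0≤n⇒0≤n/ℕd)
open import Data.List using (List; []; _∷_; _++_; map; filter; allFin)
open import Data.List.Membership.Propositional using () renaming (_∈_ to _∈ₗ_)
open import Data.List.Membership.Propositional.Properties using (∈-map⁺; ∈-++⁺ˡ; ∈-++⁺ʳ; ∈-filter⁺; ∈-allFin)
open import Data.List.Relation.Unary.All as All using (All; []; _∷_)
open import Data.List.Relation.Unary.All.Properties using (all-filter; ++⁺)
open import Data.List.Relation.Unary.Any using () renaming (here to hereₗ; there to thereₗ)
open import Data.Nat using (zero; suc)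
import Data.Nat as ℕ
open import Data.Nat.Induction using (<-wellFounded)
import Data.Nat.Properties as ℕₚ
import Data.Nat.Coprimality as Coprime
open import Data.Product using (_,_; proj₁; proj₂)
open import Data.Rational hiding (∣_∣)
open import Data.Rational.Properties
open import Data.Rational.Solver using (module +-*-Solver)
open import Data.Sum using (_⊎_; inj₁; inj₂)
open import Data.Vec using ([]; _∷_; lookup; tabulate; here; there)
open import Data.Vec.Properties using (lookup-zipWith; lookup∘tabulate; []=⇒lookup; lookup⇒[]=)
open import Function using (_∘_)
open import Induction.WellFounded using (Acc; acc)
open import Relation.Binary.Bundles using (DecTotalOrder)
open import Relation.Binary.PropositionalEquality
open import Relation.Nullary using (¬_; ¬?; Dec; yes; no; does; _×-dec_; _⊎-dec_; contradiction)

open import Algebra.Properties.CommutativeSemigroup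
  (CommutativeMonoid.commutativeSemigroup +-0-commutativeMonoid) using () renaming (interchange to +-interchange)
import Data.List.Extrema (DecTotalOrder.totalOrder ≤-decTotalOrder) as Extrema
open +-*-Solver

-- Write a = ⌊x⌋ and g(X) = ρ(X) − a(X).  As a ∈ P, g is a nonnegative integer-valued submodular
-- function with g(∅) = 0, and y ∈ P ∩ C(x) iff z = y − a lies in Q(g) = {z ∈ [0,1]^E : z(X) ≤ g(X)}.
--
-- The sets I with χ_I ∈ Q(g) form a matroid M.  For the exchange axiom, suppose I + e is dependent
-- for every e ∈ J − I.  Integrality of g makes each such e lie in a tight set of χ_I; tight sets are
-- closed under union by submodularity, so the union U of all of them is tight, whence
-- |J ∩ U| ≤ g(U) = |I ∩ U|, while J − U ⊆ I.  Thus |J| ≤ |I|.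
--
-- Q(g) = P(M) because Q(g) is integral.  If z ∈ Q(g) has a fractional coordinate e, there is a
-- direction d with d(e) = 1 along which every active constraint stays active: δ_e if no tight set
-- contains e, and otherwise δ_e − δ_f, where f ≠ e is a fractional coordinate of a minimal tight set
-- around e that no tight set separates from e (such an f exists because g(T) is an integer and tight
-- sets are closed under intersection).  Moving from z along d and −d until a new constraint becomes
-- active writes z as a convex combination of two points of Q(g) with more active constraints; by
-- induction z is a convex combination of 0/1-points of Q(g), which are the χ_I with I independent.

ℤ→ℚ≡mkℚ : ∀ a → ℤ→ℚ a ≡ mkℚ a 0 (Coprime.sym (Coprime.1-coprimeTo _))
ℤ→ℚ≡mkℚ a = ↥p/↧p≡p (mkℚ a 0 (Coprime.sym (Coprime.1-coprimeTo _)))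

ℤ→ℚ-+ : ∀ a b → ℤ→ℚ (a ℤ.+ b) ≡ ℤ→ℚ a + ℤ→ℚ b
ℤ→ℚ-+ a b rewrite ℤ→ℚ≡mkℚ a | ℤ→ℚ≡mkℚ b =
  sym (/-cong (cong₂ ℤ._+_ (ℤₚ.*-identityʳ a) (ℤₚ.*-identityʳ b)) refl)

ℤ→ℚ-neg : ∀ a → ℤ→ℚ (ℤ.- a) ≡ - ℤ→ℚ a
ℤ→ℚ-neg a = trans (ℤ→ℚ≡mkℚ (ℤ.- a)) (trans (mkℚ-neg a) (cong -_ (sym (ℤ→ℚ≡mkℚ a))))
  where
  mkℚ-neg : ∀ a → mkℚ (ℤ.- a) 0 (Coprime.sym (Coprime.1-coprimeTo _)) ≡
                  - mkℚ a 0 (Coprime.sym (Coprime.1-coprimeTo _))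
  mkℚ-neg (ℤ.+ zero)   = refl
  mkℚ-neg ℤ.+[1+ k ]   = refl
  mkℚ-neg ℤ.-[1+ k ]   = refl

ℤ→ℚ-mono-≤ : ∀ {a b} → a ℤ.≤ b → ℤ→ℚ a ≤ ℤ→ℚ b
ℤ→ℚ-mono-≤ {a} {b} a≤b rewrite ℤ→ℚ≡mkℚ a | ℤ→ℚ≡mkℚ b =
  *≤* (subst₂ ℤ._≤_ (sym (ℤₚ.*-identityʳ a)) (sym (ℤₚ.*-identityʳ b)) a≤b)

ℤ→ℚ-cancel-≤ : ∀ {a b} → ℤ→ℚ a ≤ ℤ→ℚ b → a ℤ.≤ b
ℤ→ℚ-cancel-≤ {a} {b} a≤b rewrite ℤ→ℚ≡mkℚ a | ℤ→ℚ≡mkℚ b =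
  subst₂ ℤ._≤_ (ℤₚ.*-identityʳ a) (ℤₚ.*-identityʳ b) (drop-*≤* a≤b)

ℕ→ℚ-+ : ∀ a b → ℕ→ℚ (a ℕ.+ b) ≡ ℕ→ℚ a + ℕ→ℚ b
ℕ→ℚ-+ a b = ℤ→ℚ-+ (ℤ.+ a) (ℤ.+ b)

ℕ→ℚ-mono-≤ : ∀ {a b} → a ℕ.≤ b → ℕ→ℚ a ≤ ℕ→ℚ b
ℕ→ℚ-mono-≤ a≤b = ℤ→ℚ-mono-≤ (ℤ.+≤+ a≤b)

ℕ→ℚ-cancel-≤ : ∀ {a b} → ℕ→ℚ a ≤ ℕ→ℚ b → a ℕ.≤ b
ℕ→ℚ-cancel-≤ a≤b = ℤₚ.drop‿+≤+ (ℤ→ℚ-cancel-≤ a≤b)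

floor-≤ : ∀ q → ℤ→ℚ (floor q) ≤ q
floor-≤ q@(mkℚ m d _) rewrite ℤ→ℚ≡mkℚ (floor q) =
  *≤* (subst₂ ℤ._≤_ (cong (ℤ._* ℤ.+ suc d) (sym (div-pos-is-/ℕ m (suc d)))) (sym (ℤₚ.*-identityʳ m))
                    ([n/ℕd]*d≤n m (suc d)))

floor-nonNeg : ∀ {q} → 0ℚ ≤ q → 0ℚ ≤ ℤ→ℚ (floor q)
floor-nonNeg {mkℚ m d _} (*≤* 0≤m) = ℤ→ℚ-mono-≤ (subst (ℤ.+ 0 ℤ.≤_) (sym (div-pos-is-/ℕ m (suc d)))
  (0≤n⇒0≤n/ℕd m (suc d) (subst (ℤ.+ 0 ℤ.≤_) (ℤₚ.*-identityʳ m) 0≤m)))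

0<1 : 0ℚ < 1ℚ
0<1 = *<* (ℤ.+<+ (ℕ.s≤s ℕ.z≤n))

neg-involutive : ∀ q → - (- q) ≡ q
neg-involutive = solve 1 (λ q → :- (:- q) := q) refl

p-q+q≡p : ∀ p q → p - q + q ≡ p
p-q+q≡p = solve 2 (λ p q → p :- q :+ q := p) refl

p+q-q≡p : ∀ p q → p + q - q ≡ p
p+q-q≡p = solve 2 (λ p q → p :+ q :- q := p) refl

p+q-p≡q : ∀ p q → p + q - p ≡ q
p+q-p≡q = solve 2 (λ p q → p :+ q :- p := q) refl

+-cancelʳ-≤ : ∀ {p q} r → p + r ≤ q + r → p ≤ q
+-cancelʳ-≤ {p} {q} r p+r≤q+r = subst₂ _≤_ (p+q-q≡p p r) (p+q-q≡p q r) (+-monoˡ-≤ (- r) p+r≤q+r)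

p≤q⇒0≤q-p : ∀ {p q} → p ≤ q → 0ℚ ≤ q - p
p≤q⇒0≤q-p {p} {q} p≤q = subst (_≤ q - p) (+-inverseʳ p) (+-monoˡ-≤ (- p) p≤q)

+-squeeze : ∀ {p q r s} → p ≤ r → q ≤ s → r + s ≤ p + q → p ≡ r × q ≡ s
+-squeeze {p} {q} {r} {s} p≤r q≤s r+s≤p+q =
  ≤-antisym p≤r (+-cancelʳ-≤ s (≤-trans r+s≤p+q (+-monoʳ-≤ p q≤s))) ,
  ≤-antisym q≤s (+-cancelʳ-≤ r (subst₂ _≤_ (+-comm r s) (+-comm r q)
                                         (≤-trans r+s≤p+q (+-monoˡ-≤ q p≤r))))

*-nonNeg : ∀ {p q} → 0ℚ ≤ p → 0ℚ ≤ q → 0ℚ ≤ p * q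
*-nonNeg {p} {q} 0≤p 0≤q =
  nonNegative⁻¹ _ {{nonNeg*nonNeg⇒nonNeg p {{nonNegative 0≤p}} q {{nonNegative 0≤q}}}}

*-pos : ∀ {p q} → 0ℚ < p → 0ℚ < q → 0ℚ < p * q
*-pos {p} {q} 0<p 0<q = positive⁻¹ _ {{pos*pos⇒pos p {{positive 0<p}} q {{positive 0<q}}}}

-- A total inverse, with the junk value 0 at 0.
inv : ℚ → ℚ
inv q with q ≟ 0ℚ
... | yes _   = 0ℚ
... | no q≢0 = (1/ q) {{≢-nonZero q≢0}}

inv-*-cancel : ∀ {q} → 0ℚ < q → inv q * q ≡ 1ℚ
inv-*-cancel {q} 0<q with q ≟ 0ℚ
... | yes q≡0 = contradiction (sym q≡0) (<⇒≢ 0<q)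
... | no  q≢0 = *-inverseˡ q {{≢-nonZero q≢0}}

inv-pos : ∀ {q} → 0ℚ < q → 0ℚ < inv q
inv-pos {q} 0<q with q ≟ 0ℚ
... | yes q≡0 = contradiction (sym q≡0) (<⇒≢ 0<q)
... | no  q≢0 = positive⁻¹ _ {{1/pos⇒pos q {{positive 0<q}}}}

between-convex : ∀ {t₁ t₂} → 0ℚ < t₁ → 0ℚ < t₂ →
                 ∃[ λ₁ ] ∃[ λ₂ ] (0ℚ ≤ λ₁ × 0ℚ ≤ λ₂ × λ₁ + λ₂ ≡ 1ℚ ×
                                  ∀ a x → x ≡ λ₁ * (t₁ * a + x) + λ₂ * (t₂ * (- a) + x))
between-convex {t₁} {t₂} 0<t₁ 0<t₂ =
  t₂ * s , t₁ * s , *-nonNeg (<⇒≤ 0<t₂) (<⇒≤ 0<s) , *-nonNeg (<⇒≤ 0<t₁) (<⇒≤ 0<s) ,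
  trans (sum-identity t₁ t₂ s) (inv-*-cancel 0<t₁+t₂) ,
  λ a x → sym (trans (combination-identity t₁ t₂ s a x)
                     (trans (cong (_* x) (inv-*-cancel 0<t₁+t₂)) (*-identityˡ x)))
  where
  s = inv (t₁ + t₂)
  0<t₁+t₂ = +-mono-< 0<t₁ 0<t₂
  0<s = inv-pos 0<t₁+t₂
  sum-identity : ∀ t₁ t₂ s → t₂ * s + t₁ * s ≡ s * (t₁ + t₂)
  sum-identity = solve 3 (λ t₁ t₂ s → t₂ :* s :+ t₁ :* s := s :* (t₁ :+ t₂)) refl
  combination-identity : ∀ t₁ t₂ s a x →
    t₂ * s * (t₁ * a + x) + t₁ * s * (t₂ * (- a) + x) ≡ s * (t₁ + t₂) * x
  combination-identity = solve 5 (λ t₁ t₂ s a x →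
    t₂ :* s :* (t₁ :* a :+ x) :+ t₁ :* s :* (t₂ :* (:- a) :+ x) := s :* (t₁ :+ t₂) :* x) refl

IsInt : ℚ → Set
IsInt q = ∃[ k ] q ≡ ℤ→ℚ k

isInt-0 : IsInt 0ℚ
isInt-0 = ℤ.+ 0 , refl

isInt-1 : IsInt 1ℚ
isInt-1 = ℤ.+ 1 , refl

isInt-ℕ : ∀ k → IsInt (ℕ→ℚ k)
isInt-ℕ k = ℤ.+ k , refl

isInt-+ : ∀ {p q} → IsInt p → IsInt q → IsInt (p + q)
isInt-+ (a , refl) (b , refl) = a ℤ.+ b , sym (ℤ→ℚ-+ a b)

isInt-neg : ∀ {p} → IsInt p → IsInt (- p)
isInt-neg (a , refl) = ℤ.- a , sym (ℤ→ℚ-neg a)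

isInt-minus : ∀ {p q} → IsInt p → IsInt q → IsInt (p - q)
isInt-minus p∈ℤ q∈ℤ = isInt-+ p∈ℤ (isInt-neg q∈ℤ)

isInt-+⁻ʳ : ∀ {p q} → IsInt (p + q) → IsInt p → IsInt q
isInt-+⁻ʳ {p} {q} p+q∈ℤ p∈ℤ = subst IsInt (p+q-p≡q p q) (isInt-minus p+q∈ℤ p∈ℤ)

isInt-0≤<1⇒≡0 : ∀ {q} → IsInt q → 0ℚ ≤ q → q < 1ℚ → q ≡ 0ℚ
isInt-0≤<1⇒≡0 (ℤ.+ zero , refl) _ _ = refl
isInt-0≤<1⇒≡0 (ℤ.+[1+ m ] , refl) _ k<1 =
  contradiction (≤-<-trans (ℕ→ℚ-mono-≤ {1} {suc m} (ℕ.s≤s ℕ.z≤n)) k<1) (<-irrefl refl)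
isInt-0≤<1⇒≡0 (ℤ.-[1+ m ] , refl) 0≤k _ = contradiction (ℤ→ℚ-cancel-≤ {ℤ.+ 0} {ℤ.-[1+ m ]} 0≤k) λ ()

isInt-squeeze : ∀ {p q} → IsInt (q - p) → p ≤ q → q < p + 1ℚ → p ≡ q
isInt-squeeze {p} {q} q-p∈ℤ p≤q q<p+1 = begin
  p              ≡⟨ +-identityˡ p ⟨
  0ℚ + p         ≡⟨ cong (_+ p) (isInt-0≤<1⇒≡0 q-p∈ℤ (p≤q⇒0≤q-p p≤q) q-p<1) ⟨
  q - p + p      ≡⟨ p-q+q≡p q p ⟩
  q ∎
  where
  open ≡-Reasoning
  q-p<1 : q - p < 1ℚ
  q-p<1 = subst (q - p <_) (p+q-p≡q p 1ℚ) (+-monoˡ-< (- p) q<p+1)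

Fractional : ℚ → Set
Fractional q = 0ℚ < q × q < 1ℚ

fractional? : ∀ q → Dec (Fractional q)
fractional? q = (0ℚ <? q) ×-dec (q <? 1ℚ)

fractional⇒¬isInt : ∀ {q} → Fractional q → ¬ IsInt q
fractional⇒¬isInt (0<q , q<1) q∈ℤ = <⇒≢ 0<q (sym (isInt-0≤<1⇒≡0 q∈ℤ (<⇒≤ 0<q) q<1))

allSubsets : ∀ n → List (Subset n)
allSubsets zero    = [] ∷ []
allSubsets (suc n) = map (true ∷_) (allSubsets n) ++ map (false ∷_) (allSubsets n)

∈-allSubsets : ∀ {n} (X : Subset n) → X ∈ₗ allSubsets n
∈-allSubsets []                  = hereₗ refl
∈-allSubsets (true ∷ X)          = ∈-++⁺ˡ (∈-map⁺ (true ∷_) (∈-allSubsets X))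
∈-allSubsets {suc n} (false ∷ X) = ∈-++⁺ʳ (map (true ∷_) (allSubsets n)) (∈-map⁺ (false ∷_) (∈-allSubsets X))

∈-⋃ : ∀ {n} {x : Fin n} {X Xs} → x ∈ X → X ∈ₗ Xs → x ∈ ⋃ Xs
∈-⋃ x∈X (hereₗ refl)   = x∈p∪q⁺ (inj₁ x∈X)
∈-⋃ x∈X (thereₗ X∈Xs) = x∈p∪q⁺ (inj₂ (∈-⋃ x∈X X∈Xs))

p∩∁p≡⊥ : ∀ {n} (p : Subset n) → p ∩ ∁ p ≡ ⊥
p∩∁p≡⊥ []          = refl
p∩∁p≡⊥ (true ∷ p)  = cong (false ∷_) (p∩∁p≡⊥ p)
p∩∁p≡⊥ (false ∷ p) = cong (false ∷_) (p∩∁p≡⊥ p)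

χ-∈ : ∀ {n} {i : Fin n} {I} → i ∈ I → χ I i ≡ 1ℚ
χ-∈ i∈I rewrite []=⇒lookup i∈I = refl

χ-∉ : ∀ {n} {i : Fin n} {I} → i ∉ I → χ I i ≡ 0ℚ
χ-∉ {i = i} {I} i∉I with lookup I i in eq
... | true  = contradiction (lookup⇒[]= i I eq) i∉I
... | false = refl

χ-∪ : ∀ {n} (I J : Subset n) i → ¬ (i ∈ I × i ∈ J) → χ (I ∪ J) i ≡ χ I i + χ J i
χ-∪ I J i i∉I∩J rewrite lookup-zipWith _∨_ i I J with lookup I i in eqI | lookup J i in eqJ
... | true  | true  = contradiction (lookup⇒[]= i I eqI , lookup⇒[]= i J eqJ) i∉I∩J
... | true  | false = refl
... | false | true  = refl
... | false | false = refl

χ-nonNeg : ∀ {n} (I : Subset n) i → 0ℚ ≤ χ I i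
χ-nonNeg I i with lookup I i
... | true  = <⇒≤ 0<1
... | false = ≤-refl

χ-≤-1 : ∀ {n} (I : Subset n) i → χ I i ≤ 1ℚ
χ-≤-1 I i with lookup I i
... | true  = ≤-refl
... | false = <⇒≤ 0<1

χ-mono : ∀ {n} {I J : Subset n} {i} → (i ∈ I → i ∈ J) → χ I i ≤ χ J i
χ-mono {I = I} {J} {i} I⇒J with i ∈? I
... | yes i∈I rewrite χ-∈ i∈I | χ-∈ (I⇒J i∈I) = ≤-refl
... | no  i∉I rewrite χ-∉ i∉I = χ-nonNeg J i

isInt-χ : ∀ {n} (I : Subset n) i → IsInt (χ I i)
isInt-χ I i with lookup I i
... | true  = isInt-1
... | false = isInt-0

sumOn-outside : ∀ {n} (X : Subset n) u → sumOn (false ∷ X) u ≡ sumOn X (u ∘ suc)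
sumOn-outside X u = +-identityˡ _

sumOn-cong : ∀ {n} (X : Subset n) {u v : Vecℚ n} → (∀ i → u i ≡ v i) → sumOn X u ≡ sumOn X v
sumOn-cong []          u≗v = refl
sumOn-cong (true ∷ X)  u≗v = cong₂ _+_ (u≗v zero) (sumOn-cong X (u≗v ∘ suc))
sumOn-cong (false ∷ X) u≗v = cong (_+_ 0ℚ) (sumOn-cong X (u≗v ∘ suc))

sumOn-+ : ∀ {n} (X : Subset n) (u v : Vecℚ n) → sumOn X (λ i → u i + v i) ≡ sumOn X u + sumOn X v
sumOn-+ [] u v = refl
sumOn-+ (true ∷ X) u v = begin
  (u zero + v zero) + sumOn X (λ i → u (suc i) + v (suc i))
    ≡⟨ cong (_+_ (u zero + v zero)) (sumOn-+ X (u ∘ suc) (v ∘ suc)) ⟩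
  (u zero + v zero) + (sumOn X (u ∘ suc) + sumOn X (v ∘ suc))
    ≡⟨ +-interchange (u zero) (v zero) _ _ ⟩
  (u zero + sumOn X (u ∘ suc)) + (v zero + sumOn X (v ∘ suc)) ∎
  where open ≡-Reasoning
sumOn-+ (false ∷ X) u v = begin
  sumOn (false ∷ X) (λ i → u i + v i)   ≡⟨ sumOn-outside X (λ i → u i + v i) ⟩
  sumOn X (λ i → u (suc i) + v (suc i)) ≡⟨ sumOn-+ X (u ∘ suc) (v ∘ suc) ⟩
  sumOn X (u ∘ suc) + sumOn X (v ∘ suc) ≡⟨ cong₂ _+_ (sumOn-outside X u) (sumOn-outside X v) ⟨
  sumOn (false ∷ X) u + sumOn (false ∷ X) v ∎
  where open ≡-Reasoning

sumOn-* : ∀ {n} (X : Subset n) s (v : Vecℚ n) → sumOn X (λ i → s * v i) ≡ s * sumOn X v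
sumOn-* []         s v = sym (*-zeroʳ s)
sumOn-* (true ∷ X) s v =
  trans (cong (s * v zero +_) (sumOn-* X s (v ∘ suc))) (sym (*-distribˡ-+ s (v zero) _))
sumOn-* (false ∷ X) s v = begin
  sumOn (false ∷ X) (λ i → s * v i) ≡⟨ sumOn-outside X (λ i → s * v i) ⟩
  sumOn X (λ i → s * v (suc i))     ≡⟨ sumOn-* X s (v ∘ suc) ⟩
  s * sumOn X (v ∘ suc)             ≡⟨ cong (s *_) (sumOn-outside X v) ⟨
  s * sumOn (false ∷ X) v ∎
  where open ≡-Reasoning

sumOn-neg : ∀ {n} (X : Subset n) (v : Vecℚ n) → sumOn X (λ i → - v i) ≡ - sumOn X v
sumOn-neg X v = begin
  sumOn X (λ i → - v i)        ≡⟨ sumOn-cong X (λ i → neg-as-* (v i)) ⟩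
  sumOn X (λ i → (- 1ℚ) * v i) ≡⟨ sumOn-* X (- 1ℚ) v ⟩
  (- 1ℚ) * sumOn X v           ≡⟨ neg-as-* (sumOn X v) ⟨
  - sumOn X v ∎
  where
  open ≡-Reasoning
  neg-as-* : ∀ q → - q ≡ (- 1ℚ) * q
  neg-as-* = solve 1 (λ q → :- q := (:- con 1ℚ) :* q) refl

sumOn-mono : ∀ {n} (X : Subset n) {u v : Vecℚ n} → (∀ {i} → i ∈ X → u i ≤ v i) → sumOn X u ≤ sumOn X v
sumOn-mono []          u≤v = ≤-refl
sumOn-mono (true ∷ X)  u≤v = +-mono-≤ (u≤v here) (sumOn-mono X (u≤v ∘ there))
sumOn-mono (false ∷ X) u≤v = +-monoʳ-≤ 0ℚ (sumOn-mono X (u≤v ∘ there))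

sumOn-⊥ : ∀ {n} (u : Vecℚ n) → sumOn ⊥ u ≡ 0ℚ
sumOn-⊥ {zero}  u = refl
sumOn-⊥ {suc n} u = trans (sumOn-outside ⊥ u) (sumOn-⊥ (u ∘ suc))

sumOn-zero : ∀ {n} (X : Subset n) → sumOn X (λ _ → 0ℚ) ≡ 0ℚ
sumOn-zero []          = refl
sumOn-zero (true ∷ X)  = trans (+-identityˡ _) (sumOn-zero X)
sumOn-zero (false ∷ X) = trans (+-identityˡ _) (sumOn-zero X)

sumOn-∪-∩ : ∀ {n} (X Y : Subset n) (u : Vecℚ n) →
            sumOn (X ∪ Y) u + sumOn (X ∩ Y) u ≡ sumOn X u + sumOn Y u
sumOn-∪-∩ [] [] u = refl
sumOn-∪-∩ (b ∷ X) (c ∷ Y) u = begin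
  (u⟨ b ∨ c ⟩ + sumOn (X ∪ Y) u′) + (u⟨ b ∧ c ⟩ + sumOn (X ∩ Y) u′)
    ≡⟨ +-interchange u⟨ b ∨ c ⟩ _ u⟨ b ∧ c ⟩ _ ⟩
  (u⟨ b ∨ c ⟩ + u⟨ b ∧ c ⟩) + (sumOn (X ∪ Y) u′ + sumOn (X ∩ Y) u′)
    ≡⟨ cong₂ _+_ (head-∪-∩ b c) (sumOn-∪-∩ X Y u′) ⟩
  (u⟨ b ⟩ + u⟨ c ⟩) + (sumOn X u′ + sumOn Y u′)
    ≡⟨ +-interchange u⟨ b ⟩ u⟨ c ⟩ _ _ ⟩
  (u⟨ b ⟩ + sumOn X u′) + (u⟨ c ⟩ + sumOn Y u′) ∎
  where
  open ≡-Reasoning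
  u′ = u ∘ suc
  u⟨_⟩ : Bool → ℚ
  u⟨ b ⟩ = if b then u zero else 0ℚ
  head-∪-∩ : ∀ b c → u⟨ b ∨ c ⟩ + u⟨ b ∧ c ⟩ ≡ u⟨ b ⟩ + u⟨ c ⟩
  head-∪-∩ true  true  = refl
  head-∪-∩ true  false = refl
  head-∪-∩ false true  = +-comm (u zero) 0ℚ
  head-∪-∩ false false = refl

sumOn-∁ : ∀ {n} (X : Subset n) (u : Vecℚ n) → sumOn X u + sumOn (∁ X) u ≡ sumOn ⊤ u
sumOn-∁ X u = begin
  sumOn X u + sumOn (∁ X) u             ≡⟨ sumOn-∪-∩ X (∁ X) u ⟨
  sumOn (X ∪ ∁ X) u + sumOn (X ∩ ∁ X) u ≡⟨ cong₂ (λ Y Z → sumOn Y u + sumOn Z u) (p∪∁p≡⊤ X) (p∩∁p≡⊥ X) ⟩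
  sumOn ⊤ u + sumOn ⊥ u                 ≡⟨ cong (sumOn ⊤ u +_) (sumOn-⊥ u) ⟩
  sumOn ⊤ u + 0ℚ                        ≡⟨ +-identityʳ _ ⟩
  sumOn ⊤ u ∎
  where open ≡-Reasoning

sumOn-⊤-χ : ∀ {n} (I : Subset n) → sumOn ⊤ (χ I) ≡ ℕ→ℚ ∣ I ∣
sumOn-⊤-χ []          = refl
sumOn-⊤-χ (true ∷ I)  = trans (cong (1ℚ +_) (sumOn-⊤-χ I)) (sym (ℕ→ℚ-+ 1 ∣ I ∣))
sumOn-⊤-χ (false ∷ I) = trans (+-identityˡ _) (sumOn-⊤-χ I)

sumOn-χ⊥ : ∀ {n} (X : Subset n) → sumOn X (χ ⊥) ≡ 0ℚ
sumOn-χ⊥ X = trans (sumOn-cong X (λ i → χ-∉ {i = i} {⊥} ∉⊥)) (sumOn-zero X)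

sumOn-χ⁅⁆ : ∀ {n} (X : Subset n) e → sumOn X (χ ⁅ e ⁆) ≡ χ X e
sumOn-χ⁅⁆ (b ∷ X) zero    = trans (cong (χ (b ∷ X) zero +_) (sumOn-χ⊥ X)) (+-identityʳ _)
sumOn-χ⁅⁆ (b ∷ X) (suc e) = trans (drop-head b) (sumOn-χ⁅⁆ X e)
  where
  drop-head : ∀ b → (if b then 0ℚ else 0ℚ) + sumOn X (χ ⁅ e ⁆) ≡ sumOn X (χ ⁅ e ⁆)
  drop-head true  = +-identityˡ _
  drop-head false = +-identityˡ _

isInt-sumOn : ∀ {n} (X : Subset n) u → (∀ {i} → i ∈ X → IsInt (u i)) → IsInt (sumOn X u)
isInt-sumOn []          u u∈ℤ = isInt-0
isInt-sumOn (true ∷ X)  u u∈ℤ = isInt-+ (u∈ℤ here) (isInt-sumOn X (u ∘ suc) (u∈ℤ ∘ there))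
isInt-sumOn (false ∷ X) u u∈ℤ = isInt-+ isInt-0 (isInt-sumOn X (u ∘ suc) (u∈ℤ ∘ there))

isInt-sumOn⁻ : ∀ {n} (X : Subset n) u {e} → e ∈ X → (∀ {i} → i ∈ X → i ≢ e → IsInt (u i)) →
               IsInt (sumOn X u) → IsInt (u e)
isInt-sumOn⁻ (true ∷ X) u here u∈ℤ sum∈ℤ =
  isInt-+⁻ʳ (subst IsInt (+-comm (u zero) (sumOn X (u ∘ suc))) sum∈ℤ)
            (isInt-sumOn X (u ∘ suc) (λ i∈X → u∈ℤ (there i∈X) λ ()))
isInt-sumOn⁻ (true ∷ X) u (there e∈X) u∈ℤ sum∈ℤ =
  isInt-sumOn⁻ X (u ∘ suc) e∈X (λ i∈X i≢e → u∈ℤ (there i∈X) (i≢e ∘ suc-injective))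
               (isInt-+⁻ʳ sum∈ℤ (u∈ℤ here λ ()))
isInt-sumOn⁻ (false ∷ X) u (there e∈X) u∈ℤ sum∈ℤ =
  isInt-sumOn⁻ X (u ∘ suc) e∈X (λ i∈X i≢e → u∈ℤ (there i∈X) (i≢e ∘ suc-injective))
               (isInt-+⁻ʳ sum∈ℤ isInt-0)

∣J∣≤∣I∣-split : ∀ {n} (U : Subset n) {I J} → sumOn U (χ J) ≤ sumOn U (χ I) →
                (∀ {i} → i ∉ U → i ∈ J → i ∈ I) → ∣ J ∣ ℕ.≤ ∣ I ∣
∣J∣≤∣I∣-split U {I} {J} J≤I-on-U J-U⊆I = ℕ→ℚ-cancel-≤ (begin
  ℕ→ℚ ∣ J ∣                         ≡⟨ sumOn-⊤-χ J ⟨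
  sumOn ⊤ (χ J)                     ≡⟨ sumOn-∁ U (χ J) ⟨
  sumOn U (χ J) + sumOn (∁ U) (χ J) ≤⟨ +-mono-≤ J≤I-on-U (sumOn-mono (∁ U) (χ-mono ∘ J-U⊆I ∘ x∈∁p⇒x∉p)) ⟩
  sumOn U (χ I) + sumOn (∁ U) (χ I) ≡⟨ sumOn-∁ U (χ I) ⟩
  sumOn ⊤ (χ I)                     ≡⟨ sumOn-⊤-χ I ⟩
  ℕ→ℚ ∣ I ∣ ∎)
  where open ≤-Reasoning

count : ∀ {A : Set} {P : A → Set} → (∀ x → Dec (P x)) → List A → ℕ
count P? []       = 0
count P? (x ∷ xs) with P? x
... | yes _ = suc (count P? xs)
... | no  _ = count P? xs

module _ {A : Set} {P Q : A → Set} (P? : ∀ x → Dec (P x)) (Q? : ∀ x → Dec (Q x))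
         (Q⇒P : ∀ {x} → Q x → P x) where

  count-mono : ∀ xs → count Q? xs ℕ.≤ count P? xs
  count-mono []       = ℕ.z≤n
  count-mono (x ∷ xs) with Q? x | P? x
  ... | yes _  | yes _  = ℕ.s≤s (count-mono xs)
  ... | yes Qx | no ¬Px = contradiction (Q⇒P Qx) ¬Px
  ... | no  _  | yes _  = ℕₚ.m≤n⇒m≤1+n (count-mono xs)
  ... | no  _  | no  _  = count-mono xs

  count-< : ∀ {x xs} → x ∈ₗ xs → P x → ¬ Q x → count Q? xs ℕ.< count P? xs
  count-< {x} {.x ∷ xs} (hereₗ refl) Px ¬Qx with Q? x | P? x
  ... | yes Qx | _      = contradiction Qx ¬Qx
  ... | no  _  | yes _  = ℕ.s≤s (count-mono xs)
  ... | no  _  | no ¬Px = contradiction Px ¬Px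
  count-< {x} {y ∷ xs} (thereₗ x∈xs) Px ¬Qx with Q? y | P? y
  ... | yes _  | yes _  = ℕ.s≤s (count-< x∈xs Px ¬Qx)
  ... | yes Qy | no ¬Py = contradiction (Q⇒P Qy) ¬Py
  ... | no  _  | yes _  = ℕₚ.m≤n⇒m≤1+n (count-< x∈xs Px ¬Qx)
  ... | no  _  | no  _  = count-< x∈xs Px ¬Qx

-- Convex hulls of characteristic vectors

ConvexHullχ : ∀ {n} → (Subset n → Set) → Vecℚ n → Set
ConvexHullχ F y =
  ∃[ ps ] ( All (λ p → (0ℚ ≤ proj₁ p) × F (proj₂ p)) ps
          × coeffSum ps ≡ 1ℚ
          × (∀ i → y i ≡ combo ps i) )

module _ {n} {F : Subset n → Set} where

  private
    Coeffs = List (ℚ × Subset n)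

    scale : ℚ → Coeffs → Coeffs
    scale s = map (λ (c , I) → (s * c , I))

    coeffSum-scale : ∀ s ps → coeffSum (scale s ps) ≡ s * coeffSum ps
    coeffSum-scale s []             = sym (*-zeroʳ s)
    coeffSum-scale s ((c , I) ∷ ps) =
      trans (cong (s * c +_) (coeffSum-scale s ps)) (sym (*-distribˡ-+ s c (coeffSum ps)))

    coeffSum-++ : ∀ (ps qs : Coeffs) → coeffSum (ps ++ qs) ≡ coeffSum ps + coeffSum qs
    coeffSum-++ []             qs = sym (+-identityˡ _)
    coeffSum-++ ((c , I) ∷ ps) qs =
      trans (cong (c +_) (coeffSum-++ ps qs)) (sym (+-assoc c (coeffSum ps) (coeffSum qs)))

    combo-scale : ∀ s ps i → combo (scale s ps) i ≡ s * combo ps i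
    combo-scale s []             i = sym (*-zeroʳ s)
    combo-scale s ((c , I) ∷ ps) i =
      trans (cong₂ _+_ (*-assoc s c (χ I i)) (combo-scale s ps i))
            (sym (*-distribˡ-+ s (c * χ I i) (combo ps i)))

    combo-++ : ∀ (ps qs : Coeffs) i → combo (ps ++ qs) i ≡ combo ps i + combo qs i
    combo-++ []             qs i = sym (+-identityˡ _)
    combo-++ ((c , I) ∷ ps) qs i =
      trans (cong (c * χ I i +_) (combo-++ ps qs i)) (sym (+-assoc (c * χ I i) (combo ps i) (combo qs i)))

    scale-nonNeg : ∀ {s ps} → 0ℚ ≤ s → All (λ p → (0ℚ ≤ proj₁ p) × F (proj₂ p)) ps →
                   All (λ p → (0ℚ ≤ proj₁ p) × F (proj₂ p)) (scale s ps)
    scale-nonNeg 0≤s []                    = []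
    scale-nonNeg 0≤s ((0≤c , I∈F) ∷ ps-ok) = (*-nonNeg 0≤s 0≤c , I∈F) ∷ scale-nonNeg 0≤s ps-ok

  convexHullχ-χ : ∀ {I} → F I → ConvexHullχ F (χ I)
  convexHullχ-χ {I} I∈F =
    (1ℚ , I) ∷ [] , (<⇒≤ 0<1 , I∈F) ∷ [] , refl , λ i → sym (trans (+-identityʳ _) (*-identityˡ _))

  convexHullχ-cong : ∀ {y y′} → (∀ i → y i ≡ y′ i) → ConvexHullχ F y′ → ConvexHullχ F y
  convexHullχ-cong y≗y′ (ps , ps-ok , ps-sum , y′≗ps) = ps , ps-ok , ps-sum , λ i → trans (y≗y′ i) (y′≗ps i)

  convexHullχ-convex : ∀ {λ₁ λ₂ u v} → 0ℚ ≤ λ₁ → 0ℚ ≤ λ₂ → λ₁ + λ₂ ≡ 1ℚ →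
                       ConvexHullχ F u → ConvexHullχ F v → ConvexHullχ F (λ i → λ₁ * u i + λ₂ * v i)
  convexHullχ-convex {λ₁} {λ₂} {u} {v} 0≤λ₁ 0≤λ₂ λ₁+λ₂≡1
                     (ps , ps-ok , ps-sum , u≗ps) (qs , qs-ok , qs-sum , v≗qs) =
    scale λ₁ ps ++ scale λ₂ qs ,
    ++⁺ (scale-nonNeg 0≤λ₁ ps-ok) (scale-nonNeg 0≤λ₂ qs-ok) ,
    sum≡1 ,
    combo≡
    where
    open ≡-Reasoning
    sum≡1 : coeffSum (scale λ₁ ps ++ scale λ₂ qs) ≡ 1ℚ
    sum≡1 = begin
      coeffSum (scale λ₁ ps ++ scale λ₂ qs)           ≡⟨ coeffSum-++ (scale λ₁ ps) (scale λ₂ qs) ⟩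
      coeffSum (scale λ₁ ps) + coeffSum (scale λ₂ qs) ≡⟨ cong₂ _+_ (coeffSum-scale λ₁ ps) (coeffSum-scale λ₂ qs) ⟩
      λ₁ * coeffSum ps + λ₂ * coeffSum qs             ≡⟨ cong₂ (λ a b → λ₁ * a + λ₂ * b) ps-sum qs-sum ⟩
      λ₁ * 1ℚ + λ₂ * 1ℚ                               ≡⟨ cong₂ _+_ (*-identityʳ λ₁) (*-identityʳ λ₂) ⟩
      λ₁ + λ₂                                         ≡⟨ λ₁+λ₂≡1 ⟩
      1ℚ ∎
    combo≡ : ∀ i → λ₁ * u i + λ₂ * v i ≡ combo (scale λ₁ ps ++ scale λ₂ qs) i
    combo≡ i = begin
      λ₁ * u i + λ₂ * v i                           ≡⟨ cong₂ (λ a b → λ₁ * a + λ₂ * b) (u≗ps i) (v≗qs i) ⟩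
      λ₁ * combo ps i + λ₂ * combo qs i             ≡⟨ cong₂ _+_ (combo-scale λ₁ ps i) (combo-scale λ₂ qs i) ⟨
      combo (scale λ₁ ps) i + combo (scale λ₂ qs) i ≡⟨ combo-++ (scale λ₁ ps) (scale λ₂ qs) i ⟨
      combo (scale λ₁ ps ++ scale λ₂ qs) i ∎

-- The polytope Q(g) = { z ∈ [0,1]ⁿ : z(X) ≤ g X for all X }

module Polytope {n} (g : Subset n → ℚ) where

  InPolyhedron : Vecℚ n → Set
  InPolyhedron z = ∀ X → sumOn X z ≤ g X

  Tight : Vecℚ n → Subset n → Set
  Tight z X = sumOn X z ≡ g X

  data Constraint : Set where
    rank  : Subset n → Constraint
    upper : Fin n → Constraint
    lower : Fin n → Constraint

  lhs : Constraint → Vecℚ n → ℚ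
  lhs (rank X)  z = sumOn X z
  lhs (upper i) z = z i
  lhs (lower i) z = - z i

  rhs : Constraint → ℚ
  rhs (rank X)  = g X
  rhs (upper i) = 1ℚ
  rhs (lower i) = 0ℚ

  InQ : Vecℚ n → Set
  InQ z = ∀ c → lhs c z ≤ rhs c

  Active : Constraint → Vecℚ n → Set
  Active c z = lhs c z ≡ rhs c

  allConstraints : List Constraint
  allConstraints = map rank (allSubsets n) ++ map upper (allFin n) ++ map lower (allFin n)

  ∈-allConstraints : ∀ c → c ∈ₗ allConstraints
  ∈-allConstraints (rank X)  = ∈-++⁺ˡ (∈-map⁺ rank (∈-allSubsets X))
  ∈-allConstraints (upper i) = ∈-++⁺ʳ (map rank (allSubsets n)) (∈-++⁺ˡ (∈-map⁺ upper (∈-allFin i)))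
  ∈-allConstraints (lower i) =
    ∈-++⁺ʳ (map rank (allSubsets n)) (∈-++⁺ʳ (map upper (allFin n)) (∈-map⁺ lower (∈-allFin i)))

  lhs-cong : ∀ c {u v} → (∀ i → u i ≡ v i) → lhs c u ≡ lhs c v
  lhs-cong (rank X)  u≗v = sumOn-cong X u≗v
  lhs-cong (upper i) u≗v = u≗v i
  lhs-cong (lower i) u≗v = cong -_ (u≗v i)

  lhs-linear : ∀ c s u v → lhs c (λ i → s * u i + v i) ≡ s * lhs c u + lhs c v
  lhs-linear (rank X)  s u v = trans (sumOn-+ X (λ i → s * u i) v) (cong (_+ sumOn X v) (sumOn-* X s u))
  lhs-linear (upper i) s u v = refl
  lhs-linear (lower i) s u v = neg-linear s (u i) (v i)
    where
    neg-linear : ∀ s u v → - (s * u + v) ≡ s * (- u) + (- v)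
    neg-linear = solve 3 (λ s u v → :- (s :* u :+ v) := s :* (:- u) :+ (:- v)) refl

  lhs-neg : ∀ c u → lhs c (λ i → - u i) ≡ - lhs c u
  lhs-neg (rank X)  u = sumOn-neg X u
  lhs-neg (upper i) u = refl
  lhs-neg (lower i) u = refl

  lhs-zero : ∀ c → lhs c (λ _ → 0ℚ) ≡ 0ℚ
  lhs-zero (rank X)  = sumOn-zero X
  lhs-zero (upper i) = refl
  lhs-zero (lower i) = refl

  InQ⇒InPolyhedron : ∀ {z} → InQ z → InPolyhedron z
  InQ⇒InPolyhedron z∈Q X = z∈Q (rank X)

  InQ-nonNeg : ∀ {z} → InQ z → ∀ i → 0ℚ ≤ z i
  InQ-nonNeg {z} z∈Q i = subst (0ℚ ≤_) (neg-involutive (z i)) (neg-antimono-≤ (z∈Q (lower i)))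

  InQ-χ : ∀ {I} → InPolyhedron (χ I) → InQ (χ I)
  InQ-χ     I-indep (rank X)  = I-indep X
  InQ-χ {I} I-indep (upper i) = χ-≤-1 I i
  InQ-χ {I} I-indep (lower i) = neg-antimono-≤ (χ-nonNeg I i)

  lhs-combo-≤ : ∀ c ps → All (λ p → (0ℚ ≤ proj₁ p) × InPolyhedron (χ (proj₂ p))) ps →
                lhs c (combo ps) ≤ coeffSum ps * rhs c
  lhs-combo-≤ c [] [] = ≤-reflexive (trans (lhs-zero c) (sym (*-zeroˡ (rhs c))))
  lhs-combo-≤ c ((a , I) ∷ ps) ((0≤a , I-indep) ∷ ps-ok) = begin
    lhs c (λ i → a * χ I i + combo ps i) ≡⟨ lhs-linear c a (χ I) (combo ps) ⟩
    a * lhs c (χ I) + lhs c (combo ps)   ≤⟨ +-mono-≤ (*-monoˡ-≤-nonNeg a {{nonNegative 0≤a}} (InQ-χ {I} I-indep c))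
                                                     (lhs-combo-≤ c ps ps-ok) ⟩
    a * rhs c + coeffSum ps * rhs c      ≡⟨ *-distribʳ-+ (rhs c) a (coeffSum ps) ⟨
    (a + coeffSum ps) * rhs c ∎
    where open ≤-Reasoning

  convexHull⊆Q : ∀ {z} → ConvexHullχ (InPolyhedron ∘ χ) z → InQ z
  convexHull⊆Q {z} (ps , ps-ok , ps-sum , z≗ps) c = begin
    lhs c z             ≡⟨ lhs-cong c z≗ps ⟩
    lhs c (combo ps)    ≤⟨ lhs-combo-≤ c ps ps-ok ⟩
    coeffSum ps * rhs c ≡⟨ cong (_* rhs c) ps-sum ⟩
    1ℚ * rhs c          ≡⟨ *-identityˡ (rhs c) ⟩
    rhs c ∎
    where open ≤-Reasoning

Submodularℚ : ∀ {n} → (Subset n → ℚ) → Set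
Submodularℚ g = ∀ X Y → g (X ∪ Y) + g (X ∩ Y) ≤ g X + g Y

module SubmodularPolyhedron {n} (g : Subset n → ℚ) (g-submodular : Submodularℚ g)
                            (g-integral : ∀ X → IsInt (g X)) where

  open Polytope g public

  tight-∪-∩ : ∀ {z} → InPolyhedron z → ∀ {X Y} → Tight z X → Tight z Y →
              Tight z (X ∪ Y) × Tight z (X ∩ Y)
  tight-∪-∩ {z} z∈P {X} {Y} tight-X tight-Y = +-squeeze (z∈P (X ∪ Y)) (z∈P (X ∩ Y)) (begin
    g (X ∪ Y) + g (X ∩ Y)               ≤⟨ g-submodular X Y ⟩
    g X + g Y                           ≡⟨ cong₂ _+_ tight-X tight-Y ⟨
    sumOn X z + sumOn Y z               ≡⟨ sumOn-∪-∩ X Y z ⟨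
    sumOn (X ∪ Y) z + sumOn (X ∩ Y) z ∎)
    where open ≤-Reasoning

  inPolyhedron-or-violated : ∀ z → InPolyhedron z ⊎ ∃[ X ] g X < sumOn X z
  inPolyhedron-or-violated z with anySubset? (λ X → g X <? sumOn X z)
  ... | yes violated = inj₂ violated
  ... | no ¬violated = inj₁ λ X → ≮⇒≥ (¬violated ∘ (X ,_))

  inPolyhedron? : ∀ z → Dec (InPolyhedron z)
  inPolyhedron? z with inPolyhedron-or-violated z
  ... | inj₁ z∈P         = yes z∈P
  ... | inj₂ (X , gX<zX) = no λ z∈P → <-irrefl refl (<-≤-trans gX<zX (z∈P X))

  module Matroidal (g-⊥ : g ⊥ ≡ 0ℚ) (g-nonNeg : ∀ X → 0ℚ ≤ g X) where

    Indep : Subset n → Set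
    Indep I = InPolyhedron (χ I)

    tight-⋃ : ∀ {z} → InPolyhedron z → ∀ {Xs} → All (Tight z) Xs → Tight z (⋃ Xs)
    tight-⋃ {z} z∈P []                   = trans (sumOn-⊥ z) (sym g-⊥)
    tight-⋃     z∈P (tight-X ∷ tight-Xs) = proj₁ (tight-∪-∩ z∈P tight-X (tight-⋃ z∈P tight-Xs))

    maxTight : Vecℚ n → Subset n
    maxTight z = ⋃ (filter (λ X → sumOn X z ≟ g X) (allSubsets n))

    maxTight-tight : ∀ {z} → InPolyhedron z → Tight z (maxTight z)
    maxTight-tight z∈P = tight-⋃ z∈P (all-filter _ (allSubsets n))

    tight⊆maxTight : ∀ {z X i} → Tight z X → i ∈ X → i ∈ maxTight z
    tight⊆maxTight {X = X} tight-X i∈X = ∈-⋃ i∈X (∈-filter⁺ _ (∈-allSubsets X) tight-X)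

    augment-or-tight : ∀ {I e} → Indep I → e ∉ I → Indep (I ∪ ⁅ e ⁆) ⊎ ∃[ X ] (Tight (χ I) X × e ∈ X)
    augment-or-tight {I} {e} I-indep e∉I with inPolyhedron-or-violated (χ (I ∪ ⁅ e ⁆))
    ... | inj₁ I+e-indep  = inj₁ I+e-indep
    ... | inj₂ (X , gX<)  = inj₂ (X , violated-tight X (subst (g X <_) sum-I+e gX<))
      where
      sum-I+e : sumOn X (χ (I ∪ ⁅ e ⁆)) ≡ sumOn X (χ I) + χ X e
      sum-I+e = begin
        sumOn X (χ (I ∪ ⁅ e ⁆))          ≡⟨ sumOn-cong X (λ i → χ-∪ I ⁅ e ⁆ i disjoint) ⟩
        sumOn X (λ i → χ I i + χ ⁅ e ⁆ i) ≡⟨ sumOn-+ X (χ I) (χ ⁅ e ⁆) ⟩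
        sumOn X (χ I) + sumOn X (χ ⁅ e ⁆) ≡⟨ cong (sumOn X (χ I) +_) (sumOn-χ⁅⁆ X e) ⟩
        sumOn X (χ I) + χ X e ∎
        where
        open ≡-Reasoning
        disjoint : ∀ {i} → ¬ (i ∈ I × i ∈ ⁅ e ⁆)
        disjoint (i∈I , i∈⁅e⁆) = e∉I (subst (_∈ I) (x∈⁅y⁆⇒x≡y e i∈⁅e⁆) i∈I)
      violated-tight : ∀ X → g X < sumOn X (χ I) + χ X e → Tight (χ I) X × e ∈ X
      violated-tight X gX< with e ∈? X
      ... | yes e∈X rewrite χ-∈ e∈X =
        isInt-squeeze (isInt-minus (g-integral X) (isInt-sumOn X (χ I) (λ {i} _ → isInt-χ I i)))
                      (I-indep X) gX< , e∈X
      ... | no e∉X rewrite χ-∉ e∉X =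
        contradiction (<-≤-trans gX< (subst (_≤ g X) (sym (+-identityʳ _)) (I-indep X))) (<-irrefl refl)

    exchange : ∀ I J → Indep I → Indep J → ∣ I ∣ ℕ.< ∣ J ∣ → ∃[ e ] (e ∈ J × e ∉ I × Indep (I ∪ ⁅ e ⁆))
    exchange I J I-indep J-indep ∣I∣<∣J∣
      with any? (λ e → e ∈? J ×-dec ¬? (e ∈? I) ×-dec inPolyhedron? (χ (I ∪ ⁅ e ⁆)))
    ... | yes augmentable = augmentable
    ... | no ¬augmentable = contradiction (∣J∣≤∣I∣-split U J≤I-on-U J-U⊆I) (ℕₚ.<⇒≱ ∣I∣<∣J∣)
      where
      U = maxTight (χ I)
      J≤I-on-U : sumOn U (χ J) ≤ sumOn U (χ I)
      J≤I-on-U = ≤-trans (J-indep U) (≤-reflexive (sym (maxTight-tight I-indep)))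
      J-U⊆I : ∀ {i} → i ∉ U → i ∈ J → i ∈ I
      J-U⊆I {i} i∉U i∈J with i ∈? I
      ... | yes i∈I = i∈I
      ... | no  i∉I with augment-or-tight I-indep i∉I
      ...   | inj₁ I+i-indep       = contradiction (i , i∈J , i∉I , I+i-indep) ¬augmentable
      ...   | inj₂ (X , tight-X , i∈X) = contradiction (tight⊆maxTight tight-X i∈X) i∉U

    matroid : Matroid n
    matroid = record
      { Indep      = Indep
      ; indep-∅    = λ X → subst (_≤ g X) (sym (sumOn-χ⊥ X)) (g-nonNeg X)
      ; indep-down = λ I J I⊆J J-indep X → ≤-trans (sumOn-mono X (λ _ → χ-mono I⊆J)) (J-indep X)
      ; exchange   = exchange
      }

  ¬fractional⇒0∨1 : ∀ {z} → InQ z → ∀ {i} → ¬ Fractional (z i) → z i ≡ 0ℚ ⊎ z i ≡ 1ℚ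
  ¬fractional⇒0∨1 {z} z∈Q {i} ¬frac with 0ℚ <? z i | z i <? 1ℚ
  ... | yes 0<zᵢ | yes zᵢ<1 = contradiction (0<zᵢ , zᵢ<1) ¬frac
  ... | no  0≮zᵢ | _        = inj₁ (≤-antisym (≮⇒≥ 0≮zᵢ) (InQ-nonNeg z∈Q i))
  ... | _        | no zᵢ≮1  = inj₂ (≤-antisym (z∈Q (upper i)) (≮⇒≥ zᵢ≮1))

  ¬fractional⇒isInt : ∀ {z} → InQ z → ∀ {i} → ¬ Fractional (z i) → IsInt (z i)
  ¬fractional⇒isInt z∈Q ¬frac with ¬fractional⇒0∨1 z∈Q ¬frac
  ... | inj₁ zᵢ≡0 = subst IsInt (sym zᵢ≡0) isInt-0
  ... | inj₂ zᵢ≡1 = subst IsInt (sym zᵢ≡1) isInt-1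

  PreservesActive : Vecℚ n → Vecℚ n → Set
  PreservesActive z d = ∀ c → Active c z → lhs c d ≡ 0ℚ

  Direction : Vecℚ n → Set
  Direction z = ∃[ d ] (PreservesActive z d × ∃[ e ] d e ≡ 1ℚ)

  preservesActive : ∀ {z d} → (∀ X → Tight z X → sumOn X d ≡ 0ℚ) → (∀ i → ¬ Fractional (z i) → d i ≡ 0ℚ) →
                    PreservesActive z d
  preservesActive tight⇒0 integral⇒0 (rank X)  active = tight⇒0 X active
  preservesActive tight⇒0 integral⇒0 (upper i) active =
    integral⇒0 i λ (_ , zᵢ<1) → <-irrefl active zᵢ<1
  preservesActive tight⇒0 integral⇒0 (lower i) active =
    cong -_ (integral⇒0 i λ (0<zᵢ , _) → <-irrefl (sym (neg-zero active)) 0<zᵢ)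
    where
    neg-zero : ∀ {q} → - q ≡ 0ℚ → q ≡ 0ℚ
    neg-zero {q} -q≡0 = trans (sym (neg-involutive q)) (cong -_ -q≡0)

  ¬fractional-∉⁅⁆ : ∀ (z : Vecℚ n) {a i} → Fractional (z a) → ¬ Fractional (z i) → i ∉ ⁅ a ⁆
  ¬fractional-∉⁅⁆ z {a} frac-a ¬frac i∈⁅a⁆ = ¬frac (subst (Fractional ∘ z) (sym (x∈⁅y⁆⇒x≡y a i∈⁅a⁆)) frac-a)

  direction-χ⁅⁆ : ∀ {z e} → Fractional (z e) → (∀ X → Tight z X → e ∉ X) → Direction z
  direction-χ⁅⁆ {z} {e} frac-e tight⇒e∉ =
    χ ⁅ e ⁆ , preservesActive tight⇒0 integral⇒0 , e , χ-∈ (x∈⁅x⁆ e)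
    where
    tight⇒0 : ∀ X → Tight z X → sumOn X (χ ⁅ e ⁆) ≡ 0ℚ
    tight⇒0 X tight-X = trans (sumOn-χ⁅⁆ X e) (χ-∉ (tight⇒e∉ X tight-X))
    integral⇒0 : ∀ i → ¬ Fractional (z i) → χ ⁅ e ⁆ i ≡ 0ℚ
    integral⇒0 i ¬frac = χ-∉ (¬fractional-∉⁅⁆ z {e} {i} frac-e ¬frac)

  direction-χ⁅⁆-χ⁅⁆ : ∀ {z e f} → Fractional (z e) → Fractional (z f) → f ≢ e →
                      (∀ X → Tight z X → χ X e ≡ χ X f) → Direction z
  direction-χ⁅⁆-χ⁅⁆ {z} {e} {f} frac-e frac-f f≢e tight⇒e≈f =
    d , preservesActive tight⇒0 integral⇒0 , e , d-e≡1
    where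
    d : Vecℚ n
    d i = χ ⁅ e ⁆ i - χ ⁅ f ⁆ i
    d-e≡1 : d e ≡ 1ℚ
    d-e≡1 = cong₂ _-_ (χ-∈ (x∈⁅x⁆ e)) (χ-∉ (f≢e ∘ sym ∘ x∈⁅y⁆⇒x≡y f))
    tight⇒0 : ∀ X → Tight z X → sumOn X d ≡ 0ℚ
    tight⇒0 X tight-X = begin
      sumOn X d                                     ≡⟨ sumOn-+ X (χ ⁅ e ⁆) (λ i → - χ ⁅ f ⁆ i) ⟩
      sumOn X (χ ⁅ e ⁆) + sumOn X (λ i → - χ ⁅ f ⁆ i) ≡⟨ cong (sumOn X (χ ⁅ e ⁆) +_) (sumOn-neg X (χ ⁅ f ⁆)) ⟩
      sumOn X (χ ⁅ e ⁆) - sumOn X (χ ⁅ f ⁆)         ≡⟨ cong₂ _-_ (sumOn-χ⁅⁆ X e) (sumOn-χ⁅⁆ X f) ⟩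
      χ X e - χ X f                                 ≡⟨ cong (_- χ X f) (tight⇒e≈f X tight-X) ⟩
      χ X f - χ X f                                 ≡⟨ +-inverseʳ (χ X f) ⟩
      0ℚ ∎
      where open ≡-Reasoning
    integral⇒0 : ∀ i → ¬ Fractional (z i) → d i ≡ 0ℚ
    integral⇒0 i ¬frac = cong₂ _-_ (χ-∉ (¬fractional-∉⁅⁆ z {e} {i} frac-e ¬frac))
                                    (χ-∉ (¬fractional-∉⁅⁆ z {f} {i} frac-f ¬frac))

  fractional-partner : ∀ {z T e} → InQ z → Tight z T → e ∈ T → Fractional (z e) →
                       ∃[ f ] (f ∈ T × f ≢ e × Fractional (z f))
  fractional-partner {z} {T} {e} z∈Q tight-T e∈T frac-e
    with any? (λ f → f ∈? T ×-dec ¬? (f ≟ᶠ e) ×-dec fractional? (z f))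
  ... | yes partner = partner
  ... | no ¬partner = contradiction (isInt-sumOn⁻ T z e∈T others-integral (subst IsInt (sym tight-T) (g-integral T)))
                                    (fractional⇒¬isInt frac-e)
    where
    others-integral : ∀ {i} → i ∈ T → i ≢ e → IsInt (z i)
    others-integral {i} i∈T i≢e = ¬fractional⇒isInt z∈Q {i} λ frac-i → ¬partner (i , i∈T , i≢e , frac-i)

  separated-or-twins : ∀ z e f → ∃[ X ] (Tight z X × (e ∈ X × f ∉ X ⊎ f ∈ X × e ∉ X)) ⊎
                                 (∀ X → Tight z X → χ X e ≡ χ X f)
  separated-or-twins z e f
    with anySubset? (λ X → (sumOn X z ≟ g X) ×-dec ((e ∈? X ×-dec ¬? (f ∈? X)) ⊎-dec (f ∈? X ×-dec ¬? (e ∈? X))))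
  ... | yes separated = inj₁ separated
  ... | no ¬separated = inj₂ twins
    where
    twins : ∀ X → Tight z X → χ X e ≡ χ X f
    twins X tight-X with e ∈? X | f ∈? X
    ... | yes e∈X | yes f∈X = trans (χ-∈ e∈X) (sym (χ-∈ f∈X))
    ... | no  e∉X | no  f∉X = trans (χ-∉ e∉X) (sym (χ-∉ f∉X))
    ... | yes e∈X | no  f∉X = contradiction (X , tight-X , inj₁ (e∈X , f∉X)) ¬separated
    ... | no  e∉X | yes f∈X = contradiction (X , tight-X , inj₂ (f∈X , e∉X)) ¬separated

  shrink-tight : ∀ {z T X a b} → InQ z → Tight z T → Tight z X → a ∈ T → a ∈ X → b ∈ T → b ∉ X →
                 Tight z (T ∩ X) × a ∈ T ∩ X × ∣ T ∩ X ∣ ℕ.< ∣ T ∣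
  shrink-tight {T = T} {X} {b = b} z∈Q tight-T tight-X a∈T a∈X b∈T b∉X =
    proj₂ (tight-∪-∩ (InQ⇒InPolyhedron z∈Q) tight-T tight-X) ,
    x∈p∩q⁺ (a∈T , a∈X) ,
    p⊂q⇒∣p∣<∣q∣ (p∩q⊆p T X , b , b∈T , b∉X ∘ proj₂ ∘ x∈p∩q⁻ T X)

  direction-within : ∀ {z T e} → InQ z → Tight z T → e ∈ T → Fractional (z e) → Acc ℕ._<_ ∣ T ∣ → Direction z
  direction-within {z} {T} {e} z∈Q tight-T e∈T frac-e (acc smaller)
    with fractional-partner z∈Q tight-T e∈T frac-e
  ... | f , f∈T , f≢e , frac-f with separated-or-twins z e f
  ...   | inj₂ twins = direction-χ⁅⁆-χ⁅⁆ frac-e frac-f f≢e twins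
  ...   | inj₁ (X , tight-X , inj₁ (e∈X , f∉X)) =
    let tight-T∩X , e∈T∩X , T∩X<T = shrink-tight z∈Q tight-T tight-X e∈T e∈X f∈T f∉X
    in  direction-within z∈Q tight-T∩X e∈T∩X frac-e (smaller T∩X<T)
  ...   | inj₁ (X , tight-X , inj₂ (f∈X , e∉X)) =
    let tight-T∩X , f∈T∩X , T∩X<T = shrink-tight z∈Q tight-T tight-X f∈T f∈X e∈T e∉X
    in  direction-within z∈Q tight-T∩X f∈T∩X frac-f (smaller T∩X<T)

  direction : ∀ {z e} → InQ z → Fractional (z e) → Direction z
  direction {z} {e} z∈Q frac-e with anySubset? (λ T → (sumOn T z ≟ g T) ×-dec (e ∈? T))
  ... | yes (T , tight-T , e∈T) = direction-within z∈Q tight-T e∈T frac-e (<-wellFounded ∣ T ∣)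
  ... | no ¬tight∋e = direction-χ⁅⁆ frac-e λ X tight-X e∈X → ¬tight∋e (X , tight-X , e∈X)

  nonActive : Vecℚ n → ℕ
  nonActive z = count (λ c → ¬? (lhs c z ≟ rhs c)) allConstraints

  move : ℚ → Vecℚ n → Vecℚ n → Vecℚ n
  move t d z i = t * d i + z i

  -- Ratio test: t is the largest step along d that stays in Q, and the constraint c* attaining it
  -- becomes active.
  lineSearch : ∀ {z d} → InQ z → PreservesActive z d → ∀ c₀ → 0ℚ < lhs c₀ d →
               ∃[ t ] (0ℚ < t × InQ (move t d z) × nonActive (move t d z) ℕ.< nonActive z)
  lineSearch {z} {d} z∈Q preserves c₀ 0<c₀d = t , 0<t , feasible , fewer-nonActive
    where
    slack : Constraint → ℚ
    slack c = rhs c - lhs c z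
    ratio : Constraint → ℚ
    ratio c = slack c * inv (lhs c d)
    increasing? : ∀ c → Dec (0ℚ < lhs c d)
    increasing? c = 0ℚ <? lhs c d
    increasing = filter increasing? allConstraints

    c* = Extrema.argmin ratio c₀ increasing
    t = ratio c*

    0<c*d : 0ℚ < lhs c* d
    0<c*d = Extrema.argmin-all ratio 0<c₀d (all-filter increasing? allConstraints)

    c*-minimal : ∀ c → 0ℚ < lhs c d → t ≤ ratio c
    c*-minimal c 0<cd =
      All.lookup (Extrema.f[argmin]≤f[xs] c₀ increasing) (∈-filter⁺ increasing? (∈-allConstraints c) 0<cd)

    ratio-* : ∀ {c} → 0ℚ < lhs c d → ratio c * lhs c d ≡ slack c
    ratio-* {c} 0<cd =
      trans (*-assoc (slack c) _ _) (trans (cong (slack c *_) (inv-*-cancel 0<cd)) (*-identityʳ (slack c)))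

    c*-inactive : ¬ Active c* z
    c*-inactive active = <⇒≢ 0<c*d (sym (preserves c* active))

    0<t : 0ℚ < t
    0<t = *-pos 0<slack (inv-pos 0<c*d)
      where
      0<slack : 0ℚ < slack c*
      0<slack = ≰⇒> λ slack≤0 → c*-inactive (≤-antisym (z∈Q c*)
        (subst₂ _≤_ (p-q+q≡p (rhs c*) (lhs c* z)) (+-identityˡ (lhs c* z)) (+-monoˡ-≤ (lhs c* z) slack≤0)))

    lhs-move : ∀ c → lhs c (move t d z) ≡ t * lhs c d + lhs c z
    lhs-move c = lhs-linear c t d z

    within-slack : ∀ {c} → t * lhs c d ≤ slack c → lhs c (move t d z) ≤ rhs c
    within-slack {c} step≤slack = subst₂ _≤_ (sym (lhs-move c)) (p-q+q≡p (rhs c) (lhs c z))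
                                         (+-monoˡ-≤ (lhs c z) step≤slack)

    feasible : InQ (move t d z)
    feasible c with increasing? c
    ... | yes 0<cd = within-slack {c} (subst (t * lhs c d ≤_) (ratio-* {c} 0<cd)
                                         (*-monoʳ-≤-nonNeg (lhs c d) {{nonNegative (<⇒≤ 0<cd)}} (c*-minimal c 0<cd)))
    ... | no  0≮cd = within-slack {c} (≤-trans (subst (t * lhs c d ≤_) (*-zeroʳ t)
                                                  (*-monoˡ-≤-nonNeg t {{nonNegative (<⇒≤ 0<t)}} (≮⇒≥ 0≮cd)))
                                           (p≤q⇒0≤q-p (z∈Q c)))

    c*-active : Active c* (move t d z)
    c*-active = trans (lhs-move c*) (trans (cong (_+ lhs c* z) (ratio-* {c*} 0<c*d)) (p-q+q≡p (rhs c*) (lhs c* z)))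

    stays-active : ∀ {c} → Active c z → Active c (move t d z)
    stays-active {c} active = begin
      lhs c (move t d z)        ≡⟨ lhs-move c ⟩
      t * lhs c d + lhs c z     ≡⟨ cong (λ x → t * x + lhs c z) (preserves c active) ⟩
      t * 0ℚ + lhs c z          ≡⟨ cong (_+ lhs c z) (*-zeroʳ t) ⟩
      0ℚ + lhs c z              ≡⟨ +-identityˡ (lhs c z) ⟩
      lhs c z                   ≡⟨ active ⟩
      rhs c ∎
      where open ≡-Reasoning

    fewer-nonActive : nonActive (move t d z) ℕ.< nonActive z
    fewer-nonActive = count-< (λ c → ¬? (lhs c z ≟ rhs c)) (λ c → ¬? (lhs c (move t d z) ≟ rhs c))
                              (λ {c} inactive′ active → inactive′ (stays-active {c} active))
                              (∈-allConstraints c*) c*-inactive (λ inactive′ → inactive′ c*-active)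

  record Split (z : Vecℚ n) : Set where
    field
      z₁ z₂       : Vecℚ n
      λ₁ λ₂       : ℚ
      z₁∈Q        : InQ z₁
      z₂∈Q        : InQ z₂
      z₁-fewer    : nonActive z₁ ℕ.< nonActive z
      z₂-fewer    : nonActive z₂ ℕ.< nonActive z
      0≤λ₁        : 0ℚ ≤ λ₁
      0≤λ₂        : 0ℚ ≤ λ₂
      λ₁+λ₂≡1     : λ₁ + λ₂ ≡ 1ℚ
      z≡λ₁z₁+λ₂z₂ : ∀ i → z i ≡ λ₁ * z₁ i + λ₂ * z₂ i

  split : ∀ {z e} → InQ z → Fractional (z e) → Split z
  split {z} z∈Q frac-e =
    let d , preserves , e′ , d-e′≡1 = direction z∈Q frac-e
        preserves-neg : PreservesActive z (λ i → - d i)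
        preserves-neg c active = trans (lhs-neg c d) (cong -_ (preserves c active))
        t₁ , 0<t₁ , z₁∈Q , z₁-fewer =
          lineSearch z∈Q preserves (upper e′) (subst (0ℚ <_) (sym d-e′≡1) 0<1)
        t₂ , 0<t₂ , z₂∈Q , z₂-fewer =
          lineSearch z∈Q preserves-neg (lower e′) (subst (0ℚ <_) (sym (trans (neg-involutive (d e′)) d-e′≡1)) 0<1)
        λ₁ , λ₂ , 0≤λ₁ , 0≤λ₂ , λ₁+λ₂≡1 , between = between-convex 0<t₁ 0<t₂
    in record
      { z₁∈Q = z₁∈Q ; z₂∈Q = z₂∈Q ; z₁-fewer = z₁-fewer ; z₂-fewer = z₂-fewer
      ; 0≤λ₁ = 0≤λ₁ ; 0≤λ₂ = 0≤λ₂ ; λ₁+λ₂≡1 = λ₁+λ₂≡1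
      ; z≡λ₁z₁+λ₂z₂ = λ i → between (d i) (z i)
      }

  integral⇒convexHull : ∀ {z} → InQ z → (∀ i → ¬ Fractional (z i)) → ConvexHullχ (InPolyhedron ∘ χ) z
  integral⇒convexHull {z} z∈Q integral =
    convexHullχ-cong z≗χI (convexHullχ-χ {I = I} λ X → subst (_≤ g X) (sumOn-cong X z≗χI) (z∈Q (rank X)))
    where
    I : Subset n
    I = tabulate (λ i → does (z i ≟ 1ℚ))
    z≗χI : ∀ i → z i ≡ χ I i
    z≗χI i rewrite lookup∘tabulate (λ i → does (z i ≟ 1ℚ)) i
      with z i ≟ 1ℚ | ¬fractional⇒0∨1 z∈Q {i} (integral i)
    ... | yes zᵢ≡1 | _         = zᵢ≡1
    ... | no  _    | inj₁ zᵢ≡0 = zᵢ≡0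
    ... | no  zᵢ≢1 | inj₂ zᵢ≡1 = contradiction zᵢ≡1 zᵢ≢1

  InQ⊆convexHull : ∀ {z} → InQ z → ConvexHullχ (InPolyhedron ∘ χ) z
  InQ⊆convexHull z∈Q = decompose z∈Q (<-wellFounded _)
    where
    decompose : ∀ {z} → InQ z → Acc ℕ._<_ (nonActive z) → ConvexHullχ (InPolyhedron ∘ χ) z
    decompose {z} z∈Q (acc smaller) with any? (λ i → fractional? (z i))
    ... | no ¬fractional = integral⇒convexHull z∈Q (λ i frac → ¬fractional (i , frac))
    ... | yes (e , frac-e) =
      convexHullχ-cong z≡λ₁z₁+λ₂z₂
        (convexHullχ-convex 0≤λ₁ 0≤λ₂ λ₁+λ₂≡1 (decompose z₁∈Q (smaller z₁-fewer))
                                              (decompose z₂∈Q (smaller z₂-fewer)))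
      where open Split (split z∈Q frac-e)


-- Translating P ∩ C(x) by ⌊x⌋

residual : ∀ {n} → (Subset n → ℕ) → Vecℚ n → Subset n → ℚ
residual ρ a X = ℕ→ℚ (ρ X) - sumOn X a

InBox : ∀ {n} → Vecℚ n → Vecℚ n → Set
InBox a y = ∀ i → a i ≤ y i × y i ≤ a i + 1ℚ

module _ {n} (ρ : Subset n → ℕ) (a : Vecℚ n) where

  open Polytope (residual ρ a)

  residual-submodular : Submodular ρ → Submodularℚ (residual ρ a)
  residual-submodular ρ-submodular X Y = begin
    (ℕ→ℚ (ρ (X ∪ Y)) - sumOn (X ∪ Y) a) + (ℕ→ℚ (ρ (X ∩ Y)) - sumOn (X ∩ Y) a)
      ≡⟨ interchange-neg (ℕ→ℚ (ρ (X ∪ Y))) (sumOn (X ∪ Y) a) (ℕ→ℚ (ρ (X ∩ Y))) (sumOn (X ∩ Y) a) ⟩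
    (ℕ→ℚ (ρ (X ∪ Y)) + ℕ→ℚ (ρ (X ∩ Y))) - (sumOn (X ∪ Y) a + sumOn (X ∩ Y) a)
      ≡⟨ cong₂ _-_ (sym (ℕ→ℚ-+ (ρ (X ∪ Y)) (ρ (X ∩ Y)))) (sumOn-∪-∩ X Y a) ⟩
    ℕ→ℚ (ρ (X ∪ Y) ℕ.+ ρ (X ∩ Y)) - (sumOn X a + sumOn Y a)
      ≤⟨ +-monoˡ-≤ (- (sumOn X a + sumOn Y a)) (ℕ→ℚ-mono-≤ (ρ-submodular X Y)) ⟩
    ℕ→ℚ (ρ X ℕ.+ ρ Y) - (sumOn X a + sumOn Y a)
      ≡⟨ cong (_- (sumOn X a + sumOn Y a)) (ℕ→ℚ-+ (ρ X) (ρ Y)) ⟩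
    (ℕ→ℚ (ρ X) + ℕ→ℚ (ρ Y)) - (sumOn X a + sumOn Y a)
      ≡⟨ interchange-neg (ℕ→ℚ (ρ X)) (sumOn X a) (ℕ→ℚ (ρ Y)) (sumOn Y a) ⟨
    (ℕ→ℚ (ρ X) - sumOn X a) + (ℕ→ℚ (ρ Y) - sumOn Y a) ∎
    where
    open ≤-Reasoning
    interchange-neg : ∀ p q r s → (p - q) + (r - s) ≡ (p + r) - (q + s)
    interchange-neg = solve 4 (λ p q r s → (p :- q) :+ (r :- s) := (p :+ r) :- (q :+ s)) refl

  residual-integral : (∀ i → IsInt (a i)) → ∀ X → IsInt (residual ρ a X)
  residual-integral a-integral X = isInt-minus (isInt-ℕ (ρ X)) (isInt-sumOn X a (λ {i} _ → a-integral i))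

  residual-⊥ : ρ ⊥ ≡ 0 → residual ρ a ⊥ ≡ 0ℚ
  residual-⊥ ρ⊥≡0 rewrite ρ⊥≡0 | sumOn-⊥ a = refl

  residual-nonNeg : (∀ X → sumOn X a ≤ ℕ→ℚ (ρ X)) → ∀ X → 0ℚ ≤ residual ρ a X
  residual-nonNeg a∈P X = p≤q⇒0≤q-p (a∈P X)

  InP∩InBox⇒InQ : ∀ {y} → InP ρ y → InBox a y → InQ (λ i → y i - a i)
  InP∩InBox⇒InQ {y} (_ , y∈P) y∈box (rank X) = begin
    sumOn X (λ i → y i - a i)       ≡⟨ sumOn-+ X y (λ i → - a i) ⟩
    sumOn X y + sumOn X (λ i → - a i) ≡⟨ cong (sumOn X y +_) (sumOn-neg X a) ⟩
    sumOn X y - sumOn X a           ≤⟨ +-monoˡ-≤ (- sumOn X a) (y∈P X) ⟩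
    ℕ→ℚ (ρ X) - sumOn X a ∎
    where open ≤-Reasoning
  InP∩InBox⇒InQ {y} _ y∈box (upper i) =
    subst (y i - a i ≤_) (p+q-p≡q (a i) 1ℚ) (+-monoˡ-≤ (- a i) (proj₂ (y∈box i)))
  InP∩InBox⇒InQ {y} _ y∈box (lower i) = neg-antimono-≤ (p≤q⇒0≤q-p (proj₁ (y∈box i)))

  InQ⇒InP∩InBox : ∀ {y z} → (∀ i → 0ℚ ≤ a i) → InQ z → (∀ i → y i ≡ a i + z i) → InP ρ y × InBox a y
  InQ⇒InP∩InBox {y} {z} a≥0 z∈Q y≡a+z = (y≥0 , y∈P) , y∈box
    where
    y≥0 : ∀ i → 0ℚ ≤ y i
    y≥0 i = subst (0ℚ ≤_) (sym (y≡a+z i)) (+-mono-≤ (a≥0 i) (InQ-nonNeg z∈Q i))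
    y∈P : ∀ X → sumOn X y ≤ ℕ→ℚ (ρ X)
    y∈P X = begin
      sumOn X y                       ≡⟨ sumOn-cong X y≡a+z ⟩
      sumOn X (λ i → a i + z i)       ≡⟨ sumOn-+ X a z ⟩
      sumOn X a + sumOn X z           ≤⟨ +-monoʳ-≤ (sumOn X a) (z∈Q (rank X)) ⟩
      sumOn X a + (ℕ→ℚ (ρ X) - sumOn X a) ≡⟨ +-comm (sumOn X a) _ ⟩
      (ℕ→ℚ (ρ X) - sumOn X a) + sumOn X a ≡⟨ p-q+q≡p (ℕ→ℚ (ρ X)) (sumOn X a) ⟩
      ℕ→ℚ (ρ X) ∎
      where open ≤-Reasoning
    y∈box : InBox a y
    y∈box i = subst₂ _≤_ (+-identityʳ (a i)) (sym (y≡a+z i)) (+-monoʳ-≤ (a i) (InQ-nonNeg z∈Q i)) ,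
              subst (_≤ a i + 1ℚ) (sym (y≡a+z i)) (+-monoʳ-≤ (a i) (z∈Q (upper i)))

lemma13 : (n : ℕ) (ρ : Subset n → ℕ) →
          Monotone ρ → Submodular ρ → ρ ⊥ ≡ 0 →
          (x : Vecℚ n) → InP ρ x →
          ∃[ M ] (∀ (y : Vecℚ n) →
            (InP ρ y × InC x y) ⇔
            (∃[ z ] (InMatroidPolytope M z × (∀ i → y i ≡ ⌊ x ⌋ᵥ i + z i))))
lemma13 n ρ _ ρ-submodular ρ⊥≡0 x (x≥0 , x∈P) = matroid , λ y → mk⇔ to (from y)
  where
  a = ⌊ x ⌋ᵥ
  open SubmodularPolyhedron (residual ρ a) (residual-submodular ρ a ρ-submodular)
                            (residual-integral ρ a (λ i → floor (x i) , refl))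
  open Matroidal (residual-⊥ ρ a ρ⊥≡0)
                 (residual-nonNeg ρ a λ X → ≤-trans (sumOn-mono X (λ {i} _ → floor-≤ (x i))) (x∈P X))
  to : ∀ {y} → InP ρ y × InC x y → ∃[ z ] (InMatroidPolytope matroid z × (∀ i → y i ≡ a i + z i))
  to {y} (y∈P , y∈C) = (λ i → y i - a i) , InQ⊆convexHull (InP∩InBox⇒InQ ρ a y∈P y∈C) ,
                       λ i → sym (trans (+-comm (a i) _) (p-q+q≡p (y i) (a i)))
  from : ∀ y → ∃[ z ] (InMatroidPolytope matroid z × (∀ i → y i ≡ a i + z i)) → InP ρ y × InC x y
  from y (z , z∈P[M] , y≡a+z) = InQ⇒InP∩InBox ρ a (floor-nonNeg ∘ x≥0) (convexHull⊆Q z∈P[M]) y≡a+z
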